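{- Let $N\ge1$, $p$ a probability mass function on $[N]$ with $p(1)\ge\cdots\ge p(N)$, $0<\epsilon<1/2$, $\bar\epsilon=1-\epsilon$, and assume the $2N$ numbers in $\Pi=\{\epsilon p(k)\}_{k\in[N]}\cup\{\bar\epsilon p(k)\}_{k\in[N]}$ are pairwise distinct. For any bijection $\sigma:[2N]\to\Pi$ there exists a set $A\subseteq[N]$ such that $A$ and $\sigma$ are posterior-respecting. Moreover, the number of such sets $A\subseteq[N]$ is $2^c$, where $c$ is the number of connected components of $\mathcal{G}_\sigma$.
   Context: Posterior sets: $\Pi^1_A=\{\bar\epsilon p(k):k\in A\}\cup\{\epsilon p(k):k\notin A\}$, $\Pi^0_A=\{\epsilon p(k):k\in A\}\cup\{\bar\epsilon p(k):k\notin A\}$. $A$ and $\sigma$ are posterior-respecting if $\{\sigma(2k-1),\sigma(2k)\}\not\subseteq\Pi^y_A$ for all $k\in[N]$ and $y\in\{0,1\}$. $\mathcal{G}_\sigma$ is the simple graph with vertex set $\Pi$ in which two distinct vertices are adjacent iff they are posterior-siblings (equal to $\{\epsilon p(k),\bar\epsilon p(k)\}$ for some $k$) or $\sigma$-siblings (equal to $\{\sigma(2k-1),\sigma(2k)\}$ for some $k$). -}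

module Defs where

open import Level using (0ℓ)
open import Data.Nat using (ℕ; zero; suc; _^_)
open import Data.Bool using (Bool; true; false)
open import Data.Fin using (Fin; zero; suc; toℕ; combine)
open import Data.Fin.Subset using (Subset; _∈_; _∉_)
open import Data.Product using (Σ; ∃; ∃-syntax; _×_; _,_)
open import Data.Sum using (_⊎_)
open import Relation.Nullary using (¬_)
open import Relation.Binary.PropositionalEquality using (_≡_; _≢_)
open import Relation.Binary.Construct.Closure.ReflexiveTransitive using (Star)
open import Function using (_∘_)

-- An abstract number type carrying the operations and relations that the
-- hypotheses of the theorem mention (instantiate with the reals).
-- No axioms are imposed: the theorem is asserted for every such structure.
record NumStruct : Set₁ where
  field
    Carrier : Set
    _+_ _-_ _*_ : Carrier → Carrier → Carrier
    0# 1# half : Carrier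
    _<_ _≤_ : Carrier → Carrier → Set

module Setup (R : NumStruct) where
  open NumStruct R

  sumFin : ∀ {n} → (Fin n → Carrier) → Carrier
  sumFin {zero}  f = 0#
  sumFin {suc n} f = f zero + sumFin (f ∘ suc)

  -- [2N] is Fin (N * 2); for k ∈ [N] (0-indexed), the paper's indices 2k-1 and 2k
  -- are the two elements  2k  and  2k+1  of Fin (N * 2).
  first second : ∀ N → Fin N → Fin (N Data.Nat.* 2)
  first  N k = combine k zero
  second N k = combine k (suc zero)

  module Instance (N : ℕ) (p : Fin N → Carrier) (ε : Carrier) where
    ε̄ : Carrier
    ε̄ = 1# - ε

    InΠ : Carrier → Set
    InΠ x = ∃[ k ] (x ≡ ε * p k ⊎ x ≡ ε̄ * p k)

    IsBijectionOntoΠ : (Fin (N Data.Nat.* 2) → Carrier) → Set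
    IsBijectionOntoΠ σ =
      (∀ i → InΠ (σ i)) ×
      (∀ i j → σ i ≡ σ j → i ≡ j) ×
      (∀ x → InΠ x → ∃[ i ] σ i ≡ x)

    -- posterior sets Π^y_A  (y = true ↔ 1, y = false ↔ 0)
    InPost : Bool → Subset N → Carrier → Set
    InPost true  A x = ∃[ k ] ((k ∈ A × x ≡ ε̄ * p k) ⊎ (k ∉ A × x ≡ ε * p k))
    InPost false A x = ∃[ k ] ((k ∈ A × x ≡ ε * p k) ⊎ (k ∉ A × x ≡ ε̄ * p k))

    PosteriorRespecting : Subset N → (Fin (N Data.Nat.* 2) → Carrier) → Set
    PosteriorRespecting A σ =
      ∀ (k : Fin N) (y : Bool) → ¬ (InPost y A (σ (first N k)) × InPost y A (σ (second N k)))

    PairEq : Carrier → Carrier → Carrier → Carrier → Set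
    PairEq x y a b = (x ≡ a × y ≡ b) ⊎ (x ≡ b × y ≡ a)

    Adj : (Fin (N Data.Nat.* 2) → Carrier) → Carrier → Carrier → Set
    Adj σ x y = InΠ x × InΠ y × x ≢ y ×
      ( (∃[ k ] PairEq x y (ε * p k) (ε̄ * p k))
      ⊎ (∃[ k ] PairEq x y (σ (first N k)) (σ (second N k))) )

    Connected : (Fin (N Data.Nat.* 2) → Carrier) → Carrier → Carrier → Set
    Connected σ = Star (Adj σ)

    -- 𝒢_σ has exactly c connected components: there are c vertices of Π,
    -- pairwise in different components, such that every vertex lies in the
    -- component of one of them.
    HasComponents : (Fin (N Data.Nat.* 2) → Carrier) → ℕ → Set
    HasComponents σ c = Σ (Fin c → Carrier) λ r →
      (∀ i → InΠ (r i)) ×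
      (∀ i j → Connected σ (r i) (r j) → i ≡ j) ×
      (∀ x → InΠ x → ∃[ i ] Connected σ x (r i))

    CountIs : (Subset N → Set) → ℕ → Set
    CountIs P m = Σ (Fin m → Subset N) λ f →
      (∀ i j → f i ≡ f j → i ≡ j) ×
      (∀ A → P A → ∃[ i ] f i ≡ A) ×
      (∀ i → P (f i))

    PiDistinct : Set
    PiDistinct =
      (∀ k l → k ≢ l → ε * p k ≢ ε * p l) ×
      (∀ k l → k ≢ l → ε̄ * p k ≢ ε̄ * p l) ×
      (∀ k l → ε * p k ≢ ε̄ * p l)

-- Encode ε̄ p(k) by the literal x_k and ε p(k) by ¬x_k.  A set A ⊆ [N] is a truth
-- assignment, and a number lies in Π^1_A (resp. Π^0_A) exactly when its literal is true
-- (resp. false).  As the 2N numbers are distinct, σ becomes a bijection τ from [2N] onto the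
-- literals, and A is posterior-respecting iff every σ-pair of literals gets opposite values.
-- The graph 𝒢_σ thus becomes the union of two perfect matchings on the literals: the
-- complementary pairs {x_k, ¬x_k} and the σ-pairs.
--   * Existence (Literals.satisfiable): pairs covering every literal exactly once can always
--     be made opposite.  For a pair (v, v′) with v′ ≠ ¬v, let w be the partner of ¬v; solve
--     the smaller instance where (v, v′), (¬v, w) are replaced by (v′, w), then set v := w.
--   * Counting (Posterior.Components): two proper assignments agreeing at one vertex agree on
--     its whole component, and flipping a proper assignment on whole components keeps it
--     proper.  So proper assignments correspond to their values at the c component roots,
--     i.e. to Boolean functions on Fin c, which Fin (2 ^ c) enumerates (bitsOf, indexOf).
module Submission where

open import Defs
open import Data.Bool using (Bool; true; false; not; _xor_)
open import Data.Bool.Properties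
  using (not-involutive; not-¬; ¬-not; not-distribˡ-xor; xor-assoc; xor-same)
  renaming (_≟_ to _≟ᵇ_)
open import Data.Empty using (⊥-elim)
open import Data.Fin using (Fin; zero; suc; toℕ; combine; funToFin; finToFun) renaming (_≟_ to _≟ᶠ_)
open import Data.Fin.Properties using (2↔Bool; combine-injective; funToFin-finToFin; finToFun-funToFin)
open import Data.Fin.Subset using (Subset) renaming (_∉_ to _∉ₛ_)
open import Data.List using (List; []; _∷_; length)
import Data.List as List
open import Data.List.Membership.Propositional using (_∈_; _∉_)
open import Data.List.Membership.Propositional.Properties using (∈-tabulate⁺)
open import Data.List.Properties using (length-tabulate)
open import Data.List.Relation.Binary.Permutation.Propositional
  using (_↭_; ↭-refl; ↭-prep; ↭-swap; ↭-trans; ↭-sym; ↭⇒↭ₛ)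
open import Data.List.Relation.Binary.Permutation.Propositional.Properties using (∈-resp-↭; shifts)
open import Data.List.Relation.Binary.Permutation.Setoid.Properties using (Unique-resp-↭)
open import Data.List.Relation.Unary.All using (All; []; _∷_)
open import Data.List.Relation.Unary.All.Properties using (All¬⇒¬Any; tabulate⁻)
open import Data.List.Relation.Unary.Any using (here; there)
open import Data.List.Relation.Unary.AllPairs using (_∷_)
open import Data.List.Relation.Unary.Unique.Propositional using (Unique)
open import Data.List.Relation.Unary.Unique.Propositional.Properties using (tabulate⁺)
open import Data.Nat using (ℕ; zero; suc; _≥_; _^_)
import Data.Nat as ℕ
open import Data.Nat.Properties using (suc-injective)
open import Data.Product using (Σ-syntax; ∃-syntax; _×_; _,_; proj₁; proj₂)
import Data.Product
open import Data.Product.Properties using (≡-dec)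
open import Data.Sum using (_⊎_; inj₁; inj₂; [_,_])
import Data.Sum
open import Data.Vec using (lookup)
import Data.Vec as Vec
open import Data.Vec.Properties using ([]=⇒lookup; lookup⇒[]=; lookup∘tabulate; tabulate∘lookup; tabulate-cong)
open import Data.Vec.Functional using (updateAt)
open import Data.Vec.Functional.Properties using (updateAt-updates; updateAt-minimal)
open import Function using (_∘_; Inverse)
open import Relation.Binary.Construct.Closure.ReflexiveTransitive
  using (_◅_; _◅◅_; reverse) renaming (ε to [])
open import Relation.Nullary using (Dec; yes; no)
open import Relation.Binary.PropositionalEquality
  using (_≡_; _≢_; refl; sym; trans; cong; cong₂; subst; setoid; module ≡-Reasoning)

polar : Bool → Bool → Bool
polar true  x = x
polar false x = not x

polar-involutive : ∀ b x → polar b (polar b x) ≡ x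
polar-involutive true  x = refl
polar-involutive false x = not-involutive x

polar-not : ∀ b x → polar (not b) x ≡ not (polar b x)
polar-not true  x = refl
polar-not false x = sym (not-involutive x)

polar-xor : ∀ b x d → polar b (x xor d) ≡ polar b x xor d
polar-xor true  x d = refl
polar-xor false x d = not-distribˡ-xor x d

∉⇒false : ∀ {n} {A : Subset n} {k} → k ∉ₛ A → lookup A k ≡ false
∉⇒false {A = A} {k} k∉A = ¬-not (k∉A ∘ lookup⇒[]= k A)

false⇒∉ : ∀ {n} {A : Subset n} {k} → lookup A k ≡ false → k ∉ₛ A
false⇒∉ A[k]≡false k∈A = not-¬ ([]=⇒lookup k∈A) A[k]≡false

not-flip : ∀ {x y} → not x ≡ y → x ≡ not y
not-flip {x} refl = sym (not-involutive x)

occ : {A : Set} → List (A × A) → List A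
occ []              = []
occ ((u , w) ∷ ps) = u ∷ w ∷ occ ps

occ-tabulate : {A : Set} (n : ℕ) (f : Fin (n ℕ.* 2) → A) →
  occ (List.tabulate (λ (j : Fin n) → f (combine {n = 2} j zero) , f (combine j (suc zero)))) ≡ List.tabulate f
occ-tabulate zero    f = refl
occ-tabulate (suc n) f = cong (λ xs → f zero ∷ f (suc zero) ∷ xs) (occ-tabulate n (λ i → f (suc (suc i))))

module Literals (N : ℕ) where

  -- The literal (k , true) stands for the variable x_k, (k , false) for ¬x_k.
  Literal : Set
  Literal = Fin N × Bool

  Assignment : Set
  Assignment = Fin N → Bool

  _≟_ : (u v : Literal) → Dec (u ≡ v)
  _≟_ = ≡-dec _≟ᶠ_ _≟ᵇ_

  neg : Literal → Literal
  neg (k , b) = k , not b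

  neg-involutive : ∀ v → neg (neg v) ≡ v
  neg-involutive (k , b) = cong (k ,_) (not-involutive b)

  neg-≢ : ∀ v → neg v ≢ v
  neg-≢ (k , true)  ()
  neg-≢ (k , false) ()

  same-variable : ∀ u v → proj₁ u ≡ proj₁ v → u ≡ v ⊎ u ≡ neg v
  same-variable (k , true)  (.k , true)  refl = inj₁ refl
  same-variable (k , true)  (.k , false) refl = inj₂ refl
  same-variable (k , false) (.k , true)  refl = inj₂ refl
  same-variable (k , false) (.k , false) refl = inj₁ refl

  value : Assignment → Literal → Bool
  value a (k , b) = polar b (a k)

  value-resp : ∀ {a b} → (∀ k → a k ≡ b k) → ∀ v → value a v ≡ value b v
  value-resp a≗b (k , b) = cong (polar b) (a≗b k)

  value-neg : ∀ a v → value a (neg v) ≡ not (value a v)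
  value-neg a (k , b) = polar-not b (a k)

  Opposite : Assignment → Literal × Literal → Set
  Opposite a (u , w) = value a u ≡ not (value a w)

  opposite-sym : ∀ {a} u w → Opposite a (u , w) → Opposite a (w , u)
  opposite-sym {a} u w o = trans (sym (not-involutive (value a w))) (cong not (sym o))

  opposite-neg : ∀ a v → Opposite a (v , neg v)
  opposite-neg a v = opposite-sym {a} (neg v) v (value-neg a v)

  opposite-agree : ∀ {a a′} u w → value a′ u ≡ value a u → value a′ w ≡ value a w →
    Opposite a (u , w) → Opposite a′ (u , w)
  opposite-agree u w same-u same-w o = trans same-u (trans o (cong not (sym same-w)))

  opposite-resp : ∀ {a b} → (∀ k → a k ≡ b k) → ∀ uw → Opposite a uw → Opposite b uw
  opposite-resp a≗b (u , w) = opposite-agree u w (sym (value-resp a≗b u)) (sym (value-resp a≗b w))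

  opposite-cong : ∀ {a a′} M → (∀ {u} → u ∈ occ M → value a′ u ≡ value a u) →
    All (Opposite a) M → All (Opposite a′) M
  opposite-cong []              agree []       = []
  opposite-cong ((u , w) ∷ M) agree (o ∷ os) =
    opposite-agree u w (agree (here refl)) (agree (there (here refl))) o
    ∷ opposite-cong M (agree ∘ there ∘ there) os

  opposite-transfer : ∀ {a b} u w → Opposite a (u , w) → Opposite b (u , w) →
    value a u ≡ value b u → value a w ≡ value b w
  opposite-transfer u w oa ob same =
    trans (opposite-sym u w oa) (trans (cong not same) (sym (opposite-sym u w ob)))

  assign : Assignment → Literal → Bool → Assignment
  assign a (k , b) t = updateAt a k (λ _ → polar b t)

  value-assign : ∀ a v t → value (assign a v t) v ≡ t
  value-assign a (k , b) t = trans (cong (polar b) (updateAt-updates k a)) (polar-involutive b t)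

  value-assign-elsewhere : ∀ a v t u → proj₁ u ≢ proj₁ v → value (assign a v t) u ≡ value a u
  value-assign-elsewhere a (k , b) t (k′ , b′) k′≢k = cong (polar b′) (updateAt-minimal k′ k a k′≢k)

  Matching : List Literal → Set
  Matching xs = Unique xs × (∀ {v} → v ∈ xs → neg v ∈ xs)

  matching-resp-↭ : ∀ {xs ys} → xs ↭ ys → Matching xs → Matching ys
  matching-resp-↭ xs↭ys (unique , closed) =
    Unique-resp-↭ (setoid Literal) (↭⇒↭ₛ xs↭ys) unique ,
    λ m → ∈-resp-↭ xs↭ys (closed (∈-resp-↭ (↭-sym xs↭ys) m))

  neg-injective : ∀ {u v} → neg u ≡ neg v → u ≡ v
  neg-injective {u} {v} e = trans (sym (neg-involutive u)) (trans (cong neg e) (neg-involutive v))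

  matching-drop : ∀ {x R} → Matching (x ∷ neg x ∷ R) → Matching R × x ∉ R × neg x ∉ R
  matching-drop {x} {R} ((_ ∷ x≢R) ∷ nx≢R ∷ unique , closed) = (unique , closedR) , x∉R , nx∉R
    where
    x∉R : x ∉ R
    x∉R = All¬⇒¬Any x≢R
    nx∉R : neg x ∉ R
    nx∉R = All¬⇒¬Any nx≢R
    closedR : ∀ {v} → v ∈ R → neg v ∈ R
    closedR {v} v∈R with closed (there (there v∈R))
    ... | here nv≡x           = ⊥-elim (nx∉R (subst (_∈ R) (neg-injective (trans nv≡x (sym (neg-involutive x)))) v∈R))
    ... | there (here nv≡nx)  = ⊥-elim (x∉R (subst (_∈ R) (neg-injective nv≡nx) v∈R))
    ... | there (there nv∈R) = nv∈R

  extract : ∀ {x} L → x ∈ occ L →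
    Σ[ w ∈ Literal ] Σ[ M ∈ List (Literal × Literal) ]
      (occ L ↭ x ∷ w ∷ occ M) × (length L ≡ suc (length M)) ×
      (∀ a → Opposite a (x , w) → All (Opposite a) M → All (Opposite a) L)
  extract ((u , w) ∷ L) (here refl) =
    w , L , ↭-refl , refl , λ a o os → o ∷ os
  extract ((u , w) ∷ L) (there (here refl)) =
    u , L , ↭-swap u w ↭-refl , refl , λ a o os → opposite-sym {a} w u o ∷ os
  extract ((u , w) ∷ L) (there (there x∈L)) with extract L x∈L
  ... | w′ , M , L↭ , len , solves =
    w′ , (u , w) ∷ M ,
    ↭-trans (↭-prep u (↭-prep w L↭)) (shifts (u ∷ w ∷ []) (_ ∷ w′ ∷ [])) ,
    cong suc len ,
    λ { a o (o′ ∷ os) → o′ ∷ solves a o os }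

  -- Elimination step: if v and ¬v occur nowhere in (v′ , w) ∷ M, then from a solution of
  -- (v′ , w) ∷ M we obtain, by giving v the value of w, a solution of (v , v′), (¬v , w), M.
  reroute : ∀ {v v′ w} M → v ∉ occ ((v′ , w) ∷ M) → neg v ∉ occ ((v′ , w) ∷ M) →
    Σ[ a ∈ Assignment ] All (Opposite a) ((v′ , w) ∷ M) →
    Σ[ a ∈ Assignment ] Opposite a (v , v′) × Opposite a (neg v , w) × All (Opposite a) M
  reroute {v} {v′} {w} M v∉ nv∉ (a , o ∷ os) = a′ , opp-v-v′ , opp-nv-w , opposite-cong M (unchanged ∘ there ∘ there) os
    where
    a′ : Assignment
    a′ = assign a v (value a w)
    unchanged : ∀ {u} → u ∈ occ ((v′ , w) ∷ M) → value a′ u ≡ value a u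
    unchanged {u} u∈ = value-assign-elsewhere a v (value a w) u λ same →
      [ (λ { refl → v∉ u∈ }) , (λ { refl → nv∉ u∈ }) ] (same-variable u v same)
    open ≡-Reasoning
    opp-v-v′ : Opposite a′ (v , v′)
    opp-v-v′ = begin
      value a′ v          ≡⟨ value-assign a v (value a w) ⟩
      value a w           ≡⟨ opposite-sym {a} v′ w o ⟩
      not (value a v′)    ≡⟨ cong not (sym (unchanged (here refl))) ⟩
      not (value a′ v′)   ∎
    opp-nv-w : Opposite a′ (neg v , w)
    opp-nv-w = begin
      value a′ (neg v)    ≡⟨ value-neg a′ v ⟩
      not (value a′ v)    ≡⟨ cong not (value-assign a v (value a w)) ⟩
      not (value a w)     ≡⟨ cong not (sym (unchanged (there (here refl)))) ⟩
      not (value a′ w)    ∎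

  complement-later : ∀ {v v′ R} → Matching (v ∷ v′ ∷ R) → v′ ≢ neg v → neg v ∈ R
  complement-later {v} (_ , closed) v′≢nv with closed (here refl)
  ... | here nv≡v          = ⊥-elim (neg-≢ v nv≡v)
  ... | there (here nv≡v′) = ⊥-elim (v′≢nv (sym nv≡v′))
  ... | there (there nv∈R) = nv∈R

  satisfiable : ∀ n L → length L ≡ n → Matching (occ L) → Σ[ a ∈ Assignment ] All (Opposite a) L
  satisfiable _       []              _   _        = (λ _ → true) , []
  satisfiable zero    (_ ∷ _)         ()  _
  satisfiable (suc n) ((v , v′) ∷ L) len matching with v′ ≟ neg v
  ... | yes refl with satisfiable n L (suc-injective len) (proj₁ (matching-drop matching))
  ...   | a , os = a , opposite-neg a v ∷ os
  satisfiable (suc n) ((v , v′) ∷ L) len matching | no v′≢nv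
    with extract L (complement-later matching v′≢nv)
  ... | w , M , L↭ , lenM , solves
    with matching-drop (matching-resp-↭ (↭-prep v (↭-trans (↭-prep v′ L↭) (↭-swap v′ (neg v) ↭-refl))) matching)
  ... | matching′ , v∉ , nv∉
    with reroute M v∉ nv∉ (satisfiable n ((v′ , w) ∷ M) (trans (sym lenM) (suc-injective len)) matching′)
  ... | a , o₁ , o₂ , os = a , o₁ ∷ solves a o₂ os

open Inverse 2↔Bool using (to; from; inverseˡ; inverseʳ)

bitsOf : ∀ {c} → Fin (2 ^ c) → Fin c → Bool
bitsOf {c} i m = to (finToFun {2} {c} i m)

indexOf : ∀ {c} → (Fin c → Bool) → Fin (2 ^ c)
indexOf β = funToFin (from ∘ β)

bitsOf-indexOf : ∀ {c} (β : Fin c → Bool) m → bitsOf (indexOf β) m ≡ β m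
bitsOf-indexOf β m = trans (cong to (finToFun-funToFin (from ∘ β) m)) (inverseˡ refl)

funToFin-cong : ∀ {m n} {f g : Fin m → Fin n} → (∀ i → f i ≡ g i) → funToFin f ≡ funToFin g
funToFin-cong {ℕ.zero}  f≗g = refl
funToFin-cong {ℕ.suc m} f≗g = cong₂ combine (f≗g zero) (funToFin-cong (f≗g ∘ suc))

bitsOf-injective : ∀ {c} {i j : Fin (2 ^ c)} → (∀ m → bitsOf {c} i m ≡ bitsOf j m) → i ≡ j
bitsOf-injective {c} {i} {j} same = begin
  i                             ≡⟨ sym (funToFin-finToFin {c} i) ⟩
  funToFin (finToFun {2} {c} i) ≡⟨ funToFin-cong (λ m → to-injective (same m)) ⟩
  funToFin (finToFun {2} {c} j) ≡⟨ funToFin-finToFin {c} j ⟩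
  j                             ∎
  where
  open ≡-Reasoning
  to-injective : ∀ {x y} → to x ≡ to y → x ≡ y
  to-injective e = trans (sym (inverseʳ refl)) (trans (cong from e) (inverseʳ refl))

module Posterior (R : NumStruct) where
  open NumStruct R
  open Setup R

  module _ (N : ℕ) (p : Fin N → Carrier) (ε : Carrier) where
    open Instance N p ε
    open Literals N

    decode : Literal → Carrier
    decode (k , true)  = ε̄ * p k
    decode (k , false) = ε * p k

    decode-InΠ : ∀ v → InΠ (decode v)
    decode-InΠ (k , true)  = k , inj₂ refl
    decode-InΠ (k , false) = k , inj₁ refl

    InΠ⇒decode : ∀ {x} → InΠ x → Σ[ v ∈ Literal ] decode v ≡ x
    InΠ⇒decode (k , inj₁ x≡εp)  = (k , false) , sym x≡εp
    InΠ⇒decode (k , inj₂ x≡ε̄p) = (k , true)  , sym x≡ε̄p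

    module _ (distinct : PiDistinct) where

      decode-injective : ∀ u v → decode u ≡ decode v → u ≡ v
      decode-injective (k , true) (l , true) e with k ≟ᶠ l
      ... | yes refl = refl
      ... | no k≢l   = ⊥-elim (proj₁ (proj₂ distinct) k l k≢l e)
      decode-injective (k , false) (l , false) e with k ≟ᶠ l
      ... | yes refl = refl
      ... | no k≢l   = ⊥-elim (proj₁ distinct k l k≢l e)
      decode-injective (k , true)  (l , false) e = ⊥-elim (proj₂ (proj₂ distinct) l k (sym e))
      decode-injective (k , false) (l , true)  e = ⊥-elim (proj₂ (proj₂ distinct) k l e)

      inPost⇒value : ∀ A y v → InPost y A (decode v) → value (lookup A) v ≡ y
      inPost⇒value A true v (k , inj₁ (k∈A , e)) with refl ← decode-injective v (k , true) e = []=⇒lookup k∈A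
      inPost⇒value A true v (k , inj₂ (k∉A , e)) with refl ← decode-injective v (k , false) e = cong not (∉⇒false k∉A)
      inPost⇒value A false v (k , inj₁ (k∈A , e)) with refl ← decode-injective v (k , false) e = cong not ([]=⇒lookup k∈A)
      inPost⇒value A false v (k , inj₂ (k∉A , e)) with refl ← decode-injective v (k , true) e = ∉⇒false k∉A

      value⇒inPost : ∀ A y v → value (lookup A) v ≡ y → InPost y A (decode v)
      value⇒inPost A true  (k , true)  e = k , inj₁ (lookup⇒[]= k A e , refl)
      value⇒inPost A false (k , true)  e = k , inj₂ (false⇒∉ e , refl)
      value⇒inPost A true  (k , false) e = k , inj₂ (false⇒∉ (not-flip e) , refl)
      value⇒inPost A false (k , false) e = k , inj₁ (lookup⇒[]= k A (not-flip e) , refl)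

      module _ (σ : Fin (N ℕ.* 2) → Carrier) (bij : IsBijectionOntoΠ σ) where

        τ : Fin (N ℕ.* 2) → Literal
        τ i = proj₁ (InΠ⇒decode (proj₁ bij i))

        decode-τ : ∀ i → decode (τ i) ≡ σ i
        decode-τ i = proj₂ (InΠ⇒decode (proj₁ bij i))

        τ-injective : ∀ {i j} → τ i ≡ τ j → i ≡ j
        τ-injective {i} {j} e = proj₁ (proj₂ bij) i j (trans (sym (decode-τ i)) (trans (cong decode e) (decode-τ j)))

        τ-surjective : ∀ v → v ∈ List.tabulate τ
        τ-surjective v with proj₂ (proj₂ bij) (decode v) (decode-InΠ v)
        ... | i , σi≡v = subst (_∈ List.tabulate τ) (decode-injective _ _ (trans (decode-τ i) σi≡v)) (∈-tabulate⁺ i)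

        pair : Fin N → Literal × Literal
        pair k = τ (first N k) , τ (second N k)

        Proper : Assignment → Set
        Proper a = ∀ k → Opposite a (pair k)

        inPost-σ⇒value : ∀ A y i → InPost y A (σ i) → value (lookup A) (τ i) ≡ y
        inPost-σ⇒value A y i = inPost⇒value A y (τ i) ∘ subst (InPost y A) (sym (decode-τ i))

        value⇒inPost-σ : ∀ A y i → value (lookup A) (τ i) ≡ y → InPost y A (σ i)
        value⇒inPost-σ A y i = subst (InPost y A) (decode-τ i) ∘ value⇒inPost A y (τ i)

        proper⇒respecting : ∀ A → Proper (lookup A) → PosteriorRespecting A σ
        proper⇒respecting A proper k y (in₁ , in₂) =
          not-¬ (trans (inPost-σ⇒value A y _ in₁) (sym (inPost-σ⇒value A y _ in₂))) (proper k)

        respecting⇒proper : ∀ A → PosteriorRespecting A σ → Proper (lookup A)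
        respecting⇒proper A respecting k = ¬-not λ same →
          respecting k _ (value⇒inPost-σ A _ _ same , value⇒inPost-σ A _ _ refl)

        proper⇒respecting-tabulate : ∀ a → Proper a → PosteriorRespecting (Vec.tabulate a) σ
        proper⇒respecting-tabulate a proper = proper⇒respecting (Vec.tabulate a)
          (λ k → opposite-resp (λ l → sym (lookup∘tabulate a l)) (pair k) (proper k))

        pairs-matching : Matching (occ (List.tabulate pair))
        pairs-matching = subst Matching (sym (occ-tabulate N τ))
          (tabulate⁺ τ-injective , λ {v} _ → τ-surjective (neg v))

        proper-solution : Σ[ a ∈ Assignment ] Proper a
        proper-solution with satisfiable N (List.tabulate pair) (length-tabulate pair) pairs-matching
        ... | a , solves = a , tabulate⁻ solves

        existence : ∃[ A ] PosteriorRespecting A σ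
        existence = Vec.tabulate (proj₁ proper-solution) ,
                    proper⇒respecting-tabulate (proj₁ proper-solution) (proj₂ proper-solution)

        Linked : Literal → Literal → Set
        Linked u w = w ≡ neg u ⊎ Σ[ k ∈ Fin N ] (pair k ≡ (u , w) ⊎ pair k ≡ (w , u))

        adj⇒linked : ∀ {x y} → Adj σ x y →
          Σ[ u ∈ Literal ] Σ[ w ∈ Literal ] decode u ≡ x × decode w ≡ y × Linked u w
        adj⇒linked (_ , _ , _ , inj₁ (k , inj₁ (refl , refl))) = (k , false) , (k , true) , refl , refl , inj₁ refl
        adj⇒linked (_ , _ , _ , inj₁ (k , inj₂ (refl , refl))) = (k , true) , (k , false) , refl , refl , inj₁ refl
        adj⇒linked (_ , _ , _ , inj₂ (k , inj₁ (refl , refl))) = _ , _ , decode-τ _ , decode-τ _ , inj₂ (k , inj₁ refl)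
        adj⇒linked (_ , _ , _ , inj₂ (k , inj₂ (refl , refl))) = _ , _ , decode-τ _ , decode-τ _ , inj₂ (k , inj₂ refl)

        first≢second : ∀ k → first N k ≢ second N k
        first≢second k e with () ← proj₂ (combine-injective k zero k (suc zero) e)

        linked-distinct : ∀ {u w} → Linked u w → u ≢ w
        linked-distinct {u} (inj₁ refl) u≡nu = neg-≢ u (sym u≡nu)
        linked-distinct (inj₂ (k , inj₁ refl)) same = first≢second k (τ-injective same)
        linked-distinct (inj₂ (k , inj₂ refl)) same = first≢second k (τ-injective (sym same))

        linked⇒adj : ∀ {u w} → Linked u w → Adj σ (decode u) (decode w)
        linked⇒adj {u} {w} link =
          decode-InΠ u , decode-InΠ w , linked-distinct link ∘ decode-injective u w , siblings link
          where
          siblings : ∀ {u w} → Linked u w →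
            (∃[ k ] PairEq (decode u) (decode w) (ε * p k) (ε̄ * p k)) ⊎
            (∃[ k ] PairEq (decode u) (decode w) (σ (first N k)) (σ (second N k)))
          siblings             (inj₂ (k , inj₁ refl)) = inj₂ (k , inj₁ (decode-τ _ , decode-τ _))
          siblings             (inj₂ (k , inj₂ refl)) = inj₂ (k , inj₂ (decode-τ _ , decode-τ _))
          siblings {k , true}  (inj₁ refl)            = inj₁ (k , inj₂ (refl , refl))
          siblings {k , false} (inj₁ refl)            = inj₁ (k , inj₁ (refl , refl))

        adj-sym : ∀ {x y} → Adj σ x y → Adj σ y x
        adj-sym (x∈Π , y∈Π , x≢y , siblings) = y∈Π , x∈Π , x≢y ∘ sym , Data.Sum.map (Data.Product.map₂ swap) (Data.Product.map₂ swap) siblings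
          where
          swap : ∀ {x y a b} → PairEq x y a b → PairEq y x a b
          swap (inj₁ (x≡a , y≡b)) = inj₂ (y≡b , x≡a)
          swap (inj₂ (x≡b , y≡a)) = inj₁ (y≡a , x≡b)

        Agree : Assignment → Assignment → Carrier → Set
        Agree a b x = ∀ v → decode v ≡ x → value a v ≡ value b v

        linked-agree : ∀ {a b} → Proper a → Proper b → ∀ {u w} → Linked u w → value a u ≡ value b u → value a w ≡ value b w
        linked-agree {a} {b} _ _ {u} (inj₁ refl) same =
          trans (value-neg a u) (trans (cong not same) (sym (value-neg b u)))
        linked-agree {a} {b} pa pb (inj₂ (k , inj₁ refl)) =
          opposite-transfer {a} {b} (τ (first N k)) (τ (second N k)) (pa k) (pb k)
        linked-agree {a} {b} pa pb (inj₂ (k , inj₂ refl)) =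
          opposite-transfer {a} {b} (τ (second N k)) (τ (first N k))
            (opposite-sym {a} (τ (first N k)) (τ (second N k)) (pa k))
            (opposite-sym {b} (τ (first N k)) (τ (second N k)) (pb k))

        connected-agree : ∀ {a b} → Proper a → Proper b → ∀ {x y} → Connected σ x y → Agree a b x → Agree a b y
        connected-agree pa pb [] agree = agree
        connected-agree {a} {b} pa pb (edge ◅ path) agree with adj⇒linked edge
        ... | u , w , refl , refl , link = connected-agree pa pb path λ v dv≡dw →
          subst (λ v → value a v ≡ value b v) (decode-injective w v (sym dv≡dw))
                (linked-agree pa pb link (agree u refl))

        -- Counting, given c components with chosen roots: every proper assignment is the fixed
        -- one a₀ flipped on some set of components, determined by the values at the roots.
        module Components (c : ℕ) (components : HasComponents σ c) where
          a₀ : Assignment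
          a₀ = proj₁ proper-solution

          root : Fin c → Carrier
          root = proj₁ components

          roots-apart : ∀ i j → Connected σ (root i) (root j) → i ≡ j
          roots-apart = proj₁ (proj₂ (proj₂ components))

          component : Literal → Fin c
          component v = proj₁ (proj₂ (proj₂ (proj₂ components)) (decode v) (decode-InΠ v))

          to-root : ∀ v → Connected σ (decode v) (root (component v))
          to-root v = proj₂ (proj₂ (proj₂ (proj₂ components)) (decode v) (decode-InΠ v))

          from-root : ∀ v → Connected σ (root (component v)) (decode v)
          from-root v = reverse adj-sym (to-root v)

          root-literal : Fin c → Literal
          root-literal i = proj₁ (InΠ⇒decode (proj₁ (proj₂ components) i))

          decode-root-literal : ∀ i → decode (root-literal i) ≡ root i
          decode-root-literal i = proj₂ (InΠ⇒decode (proj₁ (proj₂ components) i))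

          component-root : ∀ i → component (root-literal i) ≡ i
          component-root i = sym (roots-apart i _
            (subst (λ x → Connected σ x (root (component (root-literal i))))
                   (decode-root-literal i) (to-root (root-literal i))))

          component-linked : ∀ {u w} → Linked u w → component u ≡ component w
          component-linked {u} {w} link = roots-apart _ _ (from-root u ◅◅ linked⇒adj link ◅ to-root w)

          component-var : ∀ v → component v ≡ component (proj₁ v , true)
          component-var (k , true)  = refl
          component-var (k , false) = component-linked {k , false} {k , true} (inj₁ refl)

          shift : Assignment → (Fin c → Bool) → Assignment
          shift a δ k = a k xor δ (component (k , true))

          value-shift : ∀ a δ v → value (shift a δ) v ≡ value a v xor δ (component v)
          value-shift a δ (k , b) =
            trans (polar-xor b (a k) _) (cong (λ i → polar b (a k) xor δ i) (sym (component-var (k , b))))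

          shift-proper : ∀ a δ → Proper a → Proper (shift a δ)
          shift-proper a δ proper k = begin
            value (shift a δ) u                 ≡⟨ value-shift a δ u ⟩
            value a u xor δ (component u)       ≡⟨ cong (_xor δ (component u)) (proper k) ⟩
            not (value a w) xor δ (component u) ≡⟨ sym (not-distribˡ-xor (value a w) _) ⟩
            not (value a w xor δ (component u)) ≡⟨ cong (λ i → not (value a w xor δ i)) same-component ⟩
            not (value a w xor δ (component w)) ≡⟨ cong not (sym (value-shift a δ w)) ⟩
            not (value (shift a δ) w)           ∎
            where
            open ≡-Reasoning
            u = τ (first N k)
            w = τ (second N k)
            same-component : component u ≡ component w
            same-component = component-linked (inj₂ (k , inj₁ refl))

          offset : (Fin c → Bool) → Fin c → Bool
          offset β i = value a₀ (root-literal i) xor β i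

          recolour : (Fin c → Bool) → Assignment
          recolour β = shift a₀ (offset β)

          recolour-proper : ∀ β → Proper (recolour β)
          recolour-proper β = shift-proper a₀ (offset β) (proj₂ proper-solution)

          recolour-root : ∀ β i → value (recolour β) (root-literal i) ≡ β i
          recolour-root β i = begin
            value (recolour β) r                               ≡⟨ value-shift a₀ (offset β) r ⟩
            value a₀ r xor (value a₀ (root-literal j) xor β j) ≡⟨ cong (λ j → value a₀ r xor (value a₀ (root-literal j) xor β j)) (component-root i) ⟩
            value a₀ r xor (value a₀ r xor β i)               ≡⟨ sym (xor-assoc (value a₀ r) _ _) ⟩
            (value a₀ r xor value a₀ r) xor β i               ≡⟨ cong (_xor β i) (xor-same (value a₀ r)) ⟩
            β i                                                ∎
            where
            open ≡-Reasoning
            r = root-literal i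
            j = component r

          determined-by-roots : ∀ {a b} → Proper a → Proper b →
            (∀ i → value a (root-literal i) ≡ value b (root-literal i)) → ∀ k → a k ≡ b k
          determined-by-roots {a} {b} pa pb same-roots k =
            connected-agree pa pb (from-root (k , true)) agree-at-root (k , true) refl
            where
            m = component (k , true)
            agree-at-root : Agree a b (root m)
            agree-at-root v dv≡root =
              subst (λ v → value a v ≡ value b v)
                    (decode-injective (root-literal m) v (trans (decode-root-literal m) (sym dv≡root))) (same-roots m)

          subsetOf : Fin (2 ^ c) → Subset N
          subsetOf i = Vec.tabulate (recolour (bitsOf i))

          subsetOf-respecting : ∀ i → PosteriorRespecting (subsetOf i) σ
          subsetOf-respecting i = proper⇒respecting-tabulate (recolour (bitsOf i)) (recolour-proper (bitsOf i))

          subsetOf-injective : ∀ i j → subsetOf i ≡ subsetOf j → i ≡ j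
          subsetOf-injective i j same = bitsOf-injective λ m → begin
            bitsOf i m                                   ≡⟨ sym (recolour-root (bitsOf i) m) ⟩
            value (recolour (bitsOf i)) (root-literal m) ≡⟨ value-resp same-recolouring (root-literal m) ⟩
            value (recolour (bitsOf j)) (root-literal m) ≡⟨ recolour-root (bitsOf j) m ⟩
            bitsOf j m                                   ∎
            where
            open ≡-Reasoning
            same-recolouring : ∀ k → recolour (bitsOf i) k ≡ recolour (bitsOf j) k
            same-recolouring k = trans (sym (lookup∘tabulate _ k))
              (trans (cong (λ A → lookup A k) same) (lookup∘tabulate _ k))

          subsetOf-surjective : ∀ A → PosteriorRespecting A σ → ∃[ i ] subsetOf i ≡ A
          subsetOf-surjective A respecting = indexOf β , trans (tabulate-cong agree) (tabulate∘lookup A)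
            where
            β : Fin c → Bool
            β m = value (lookup A) (root-literal m)
            agree : ∀ k → recolour (bitsOf (indexOf β)) k ≡ lookup A k
            agree = determined-by-roots (recolour-proper (bitsOf (indexOf β))) (respecting⇒proper A respecting)
              (λ m → trans (recolour-root (bitsOf (indexOf β)) m) (bitsOf-indexOf β m))

          count : CountIs (λ A → PosteriorRespecting A σ) (2 ^ c)
          count = subsetOf , subsetOf-injective , subsetOf-surjective , subsetOf-respecting

lemma5 : (R : NumStruct) → let open NumStruct R in let open Setup R in
    (N : ℕ) → N ≥ 1 →
    (p : Fin N → Carrier) →
    (∀ k → 0# ≤ p k) → sumFin p ≡ 1# →
    (∀ i j → toℕ i Data.Nat.≤ toℕ j → p j ≤ p i) →
    (ε : Carrier) → half + half ≡ 1# → 0# < ε → ε < half →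
    let open Instance N p ε in
    PiDistinct →
    (σ : Fin (N Data.Nat.* 2) → Carrier) → IsBijectionOntoΠ σ →
    (∃[ A ] PosteriorRespecting A σ) ×
    (∀ c → HasComponents σ c → CountIs (λ A → PosteriorRespecting A σ) (2 ^ c))
lemma5 R N _ p _ _ _ ε _ _ _ distinct σ bij =
  existence N p ε distinct σ bij ,
  λ c components → Components.count N p ε distinct σ bij c components
  where open Posterior R
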